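{- Let $c$ be a finite set of jobs with processing times $p_j\ge 0$ such that $p(c)\in(1/2,3/4)$ and $\max_{j\in c}p_j\le 1/2$. Then $c$ can be partitioned into two parts $\check c$ and $\hat c$ with $p(\check c)\le p(\hat c)\le 1/2$ and $1/4<p(\hat c)$.
   Context: For a set $X$ of jobs, $p(X)$ denotes the sum of the processing times of the jobs in $X$.
   Formalization: The processing times $p_j$ of the jobs take rational values. -}

module Defs where

open import Data.Nat using (ℕ; zero; suc)
open import Data.Fin using (Fin; zero; suc)
open import Data.Bool using (Bool; true; false; if_then_else_)
open import Data.Rational using (ℚ; 0ℚ; _+_)

-- Jobs are indexed by Fin n with processing times p : Fin n → ℚ.
-- A subset of jobs is a characteristic function S : Fin n → Bool.
-- p(S) = sum of p j over the jobs j with S j = true.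
load : ∀ {n} → (Fin n → ℚ) → (Fin n → Bool) → ℚ
load {zero} p S = 0ℚ
load {suc n} p S =
  (if S zero then p zero else 0ℚ) + load (λ i → p (suc i)) (λ i → S (suc i))

total : ∀ {n} → (Fin n → ℚ) → ℚ
total p = load p (λ _ → true)

{-# OPTIONS --safe #-}
-- Everything follows once the jobs fit into two bins of capacity ½: label the heavier
-- bin ĉ; its load is at least half of p(c) > ½. Two bins of capacity b suffice as soon as
-- every job is ≤ b and 2 p(c) ≤ 3 b. While the first two jobs fit into one bin together,
-- merge them into a single job and recurse. Once they do not, the remaining jobs weigh
-- less than b / 2, so the lighter of the two together with all remaining jobs stays
-- below b, and the heavier one goes alone into the other bin.
module Submission where

open import Defs
open import Data.Nat using (ℕ; zero; suc)
open import Data.Fin using (Fin; zero; suc)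
open import Data.Bool using (Bool; not; true; false; if_then_else_)
open import Data.Bool.Properties using (not-involutive)
open import Data.Integer using (+_)
open import Data.Rational using (ℚ; 0ℚ; _/_; _≤_; _<_; _+_)
open import Data.Rational.Properties
open import Data.Rational.Solver using (module +-*-Solver)
open import Data.Vec.Functional using (_∷_; head; tail)
open import Data.Product using (Σ; Σ-syntax; _×_; _,_)
open import Data.Sum using (inj₁; inj₂; [_,_]′)
open import Function using (_∘_)
open import Relation.Nullary.Decidable using (toSum)
open import Relation.Binary.PropositionalEquality
open import Algebra.Bundles using (CommutativeMonoid)
open import Algebra.Properties.CommutativeSemigroup
  (CommutativeMonoid.commutativeSemigroup +-0-commutativeMonoid)
  using (x∙yz≈y∙xz) renaming (interchange to +-interchange)

private
  variable
    n : ℕ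

load-cong : (p : Fin n → ℚ) {S T : Fin n → Bool} → (∀ j → S j ≡ T j) → load p S ≡ load p T
load-cong {zero}  p S≗T = refl
load-cong {suc n} p S≗T =
  cong₂ _+_ (cong (λ b → if b then p zero else 0ℚ) (S≗T zero)) (load-cong (tail p) (S≗T ∘ suc))

load-none : (p : Fin n → ℚ) → load p (λ _ → false) ≡ 0ℚ
load-none {zero}  p = refl
load-none {suc n} p = trans (+-identityˡ _) (load-none (tail p))

load-only-head : (p : Fin (suc n) → ℚ) → load p (true ∷ λ _ → false) ≡ p zero
load-only-head p = trans (cong (λ x → p zero + x) (load-none (tail p))) (+-identityʳ (p zero))

load-complement : (p : Fin n → ℚ) (S : Fin n → Bool) → load p S + load p (not ∘ S) ≡ total p
load-complement {zero}  p S = refl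
load-complement {suc n} p S = begin
  (pick (S zero) + L) + (pick (not (S zero)) + L′)
    ≡⟨ +-interchange (pick (S zero)) L (pick (not (S zero))) L′ ⟩
  (pick (S zero) + pick (not (S zero))) + (L + L′)
    ≡⟨ cong₂ _+_ (pick-split (S zero)) (load-complement (tail p) (tail S)) ⟩
  p zero + total (tail p)
    ∎
  where
  open ≡-Reasoning
  pick : Bool → ℚ
  pick b = if b then p zero else 0ℚ
  pick-split : ∀ b → pick b + pick (not b) ≡ p zero
  pick-split true  = +-identityʳ (p zero)
  pick-split false = +-identityˡ (p zero)
  L L′ : ℚ
  L  = load (tail p) (tail S)
  L′ = load (tail p) (not ∘ tail S)

merge-first-two : (Fin (suc (suc n)) → ℚ) → Fin (suc n) → ℚ
merge-first-two p = (p zero + p (suc zero)) ∷ tail (tail p)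

-- head S ∷ S puts both merged jobs on the side of the merged job.
load-merge-first-two : (p : Fin (suc (suc n)) → ℚ) (S : Fin (suc n) → Bool) →
                       load (merge-first-two p) S ≡ load p (head S ∷ S)
load-merge-first-two p S with S zero
... | true  = +-assoc (p zero) (p (suc zero)) _
... | false = cong (λ L → 0ℚ + L) (sym (+-identityˡ (load (tail (tail p)) (tail S))))

total-merge-first-two : (p : Fin (suc (suc n)) → ℚ) → total (merge-first-two p) ≡ total p
total-merge-first-two p = load-merge-first-two p (λ _ → true)

≡-≤-trans : ∀ {x y z} → x ≡ y → y ≤ z → x ≤ z
≡-≤-trans refl y≤z = y≤z

reflect-< : (f : ℚ → ℚ) → (∀ {x y} → x ≤ y → f x ≤ f y) → ∀ {x y} → f x < f y → x < y
reflect-< f f-mono fx<fy = ≰⇒> (λ y≤x → <-irrefl refl (<-≤-trans fx<fy (f-mono y≤x)))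

double-mono-≤ : ∀ {x y} → x ≤ y → x + x ≤ y + y
double-mono-≤ x≤y = +-mono-≤ x≤y x≤y

double<sum⇒<larger : ∀ {x y c} → y ≤ x → c + c < x + y → c < x
double<sum⇒<larger {x} y≤x 2c<x+y =
  reflect-< (λ z → z + z) double-mono-≤ (<-≤-trans 2c<x+y (+-monoʳ-≤ x y≤x))

lighter+rest<capacity : ∀ {a c r t b} → a ≤ c → b < a + c → t ≡ a + (c + r) →
                        t + t ≤ b + (b + b) → a + r < b
lighter+rest<capacity {a} {c} {r} {b = b} a≤c b<a+c refl 2t≤3b =
  reflect-< (λ x → (x + x) + b) (+-monoˡ-≤ b ∘ double-mono-≤) (begin-strict
    ((a + r) + (a + r)) + b        <⟨ +-monoʳ-< ((a + r) + (a + r)) b<a+c ⟩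
    ((a + r) + (a + r)) + (a + c)  ≡⟨ solve 3 (λ a c r → ((a :+ r) :+ (a :+ r)) :+ (a :+ c)
                                                := a :+ ((a :+ (c :+ r)) :+ (a :+ r))) refl a c r ⟩
    a + ((a + (c + r)) + (a + r))  ≤⟨ +-monoˡ-≤ _ a≤c ⟩
    c + ((a + (c + r)) + (a + r))  ≡⟨ solve 3 (λ a c r → c :+ ((a :+ (c :+ r)) :+ (a :+ r))
                                                := (a :+ (c :+ r)) :+ (a :+ (c :+ r))) refl a c r ⟩
    (a + (c + r)) + (a + (c + r))  ≤⟨ 2t≤3b ⟩
    b + (b + b)                    ≡⟨ +-assoc b b b ⟨
    (b + b) + b                    ∎)
  where open ≤-Reasoning; open +-*-Solver

FitsInTwoBins : ℚ → (Fin n → ℚ) → Set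
FitsInTwoBins b p = Σ[ S ∈ (Fin _ → Bool) ] load p S ≤ b × load p (not ∘ S) ≤ b

module _ {b : ℚ} where

  all-in-one-bin : (p : Fin n → ℚ) → 0ℚ ≤ b → total p ≤ b → FitsInTwoBins b p
  all-in-one-bin p 0≤b t≤b = (λ _ → true) , t≤b , ≡-≤-trans (load-none p) 0≤b

  merge-first-two-≤ : (p : Fin (suc (suc n)) → ℚ) → p zero + p (suc zero) ≤ b →
                      (∀ j → p j ≤ b) → ∀ j → merge-first-two p j ≤ b
  merge-first-two-≤ p p₀+p₁≤b p≤b zero    = p₀+p₁≤b
  merge-first-two-≤ p p₀+p₁≤b p≤b (suc j) = p≤b (suc (suc j))

  fits-in-two-bins-merge : (p : Fin (suc (suc n)) → ℚ) →
                           FitsInTwoBins b (merge-first-two p) → FitsInTwoBins b p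
  fits-in-two-bins-merge p (S , S≤b , Sᶜ≤b) =
    head S ∷ S ,
    ≡-≤-trans (sym (load-merge-first-two p S)) S≤b ,
    ≡-≤-trans (sym (load-merge-first-two p (not ∘ S))) Sᶜ≤b

  fits-in-two-bins-heavy-pair : (p : Fin (suc (suc n)) → ℚ) → b < p zero + p (suc zero) →
                                (∀ j → p j ≤ b) → total p + total p ≤ b + (b + b) →
                                FitsInTwoBins b p
  fits-in-two-bins-heavy-pair p b<p₀+p₁ p≤b 2t≤3b with ≤-total (p zero) (p (suc zero))
  ... | inj₁ p₀≤p₁ =
    (true ∷ false ∷ λ _ → true) ,
    ≡-≤-trans (cong (λ x → p zero + x) (+-identityˡ _))
              (<⇒≤ (lighter+rest<capacity p₀≤p₁ b<p₀+p₁ refl 2t≤3b)) ,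
    ≡-≤-trans (trans (+-identityˡ _) (load-only-head (tail p))) (p≤b (suc zero))
  ... | inj₂ p₁≤p₀ =
    (false ∷ true ∷ λ _ → true) ,
    ≡-≤-trans (+-identityˡ _) (<⇒≤ (lighter+rest<capacity p₁≤p₀ b<p₁+p₀ total-swapped 2t≤3b)) ,
    ≡-≤-trans (load-only-head p) (p≤b zero)
    where
    b<p₁+p₀ : b < p (suc zero) + p zero
    b<p₁+p₀ = subst (b <_) (+-comm (p zero) (p (suc zero))) b<p₀+p₁
    total-swapped : total p ≡ p (suc zero) + (p zero + total (tail (tail p)))
    total-swapped = x∙yz≈y∙xz (p zero) (p (suc zero)) (total (tail (tail p)))

  fits-in-two-bins : (p : Fin n → ℚ) → 0ℚ ≤ b → (∀ j → p j ≤ b) →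
                     total p + total p ≤ b + (b + b) → FitsInTwoBins b p
  fits-in-two-bins {zero}        p 0≤b p≤b 2t≤3b = all-in-one-bin p 0≤b 0≤b
  fits-in-two-bins {suc zero}    p 0≤b p≤b 2t≤3b =
    all-in-one-bin p 0≤b (≡-≤-trans (+-identityʳ (p zero)) (p≤b zero))
  -- No with or where here: seen from an auxiliary function over n, the call at suc n
  -- would not look structurally smaller to the termination checker.
  fits-in-two-bins {suc (suc n)} p 0≤b p≤b 2t≤3b =
    [ (λ p₀+p₁≤b → fits-in-two-bins-merge p
         (fits-in-two-bins (merge-first-two p) 0≤b (merge-first-two-≤ p p₀+p₁≤b p≤b)
           (subst (λ t → t + t ≤ b + (b + b)) (sym (total-merge-first-two p)) 2t≤3b)))
    , (λ p₀+p₁≰b → fits-in-two-bins-heavy-pair p (≰⇒> p₀+p₁≰b) p≤b 2t≤3b)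
    ]′ (toSum (p zero + p (suc zero) ≤? b))

  heavier-bin-first : (p : Fin n → ℚ) → FitsInTwoBins b p →
                      Σ[ S ∈ (Fin n → Bool) ] load p (not ∘ S) ≤ load p S × load p S ≤ b
  heavier-bin-first p (S , S≤b , Sᶜ≤b) with ≤-total (load p (not ∘ S)) (load p S)
  ... | inj₁ Sᶜ≤S = S , Sᶜ≤S , S≤b
  ... | inj₂ S≤Sᶜ =
    not ∘ S , ≡-≤-trans (load-cong p (not-involutive ∘ S)) S≤Sᶜ , Sᶜ≤b

lemma11 : (n : ℕ) (p : Fin n → ℚ) →
    (∀ j → 0ℚ ≤ p j) →
    (+ 1 / 2) < total p →
    total p < (+ 3 / 4) →
    (∀ j → p j ≤ (+ 1 / 2)) →
    Σ (Fin n → Bool) (λ S →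
      load p (λ j → not (S j)) ≤ load p S ×
      load p S ≤ (+ 1 / 2) ×
      (+ 1 / 4) < load p S)
lemma11 n p _ ½<total total<¾ p≤½ =
  let S , Sᶜ≤S , S≤½ = heavier-bin-first p (fits-in-two-bins p (nonNegative⁻¹ _) p≤½ 2t≤3/2)
  in S , Sᶜ≤S , S≤½ , double<sum⇒<larger Sᶜ≤S (subst (_ <_) (sym (load-complement p S)) ½<total)
  where
  2t≤3/2 : total p + total p ≤ + 1 / 2 + (+ 1 / 2 + + 1 / 2)
  2t≤3/2 = double-mono-≤ (<⇒≤ total<¾)
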